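{- Let $\varepsilon>0$, let $H:\{0,1\}^s\to\{0,1\}^n$ be an $\varepsilon$-hitting set generator for ordered branching programs of length $n$ and width $w^2$, and let $B$ be an ordered branching program of width $w$ and length $n$. Let $\{\tilde p_{x,i}\}_{x\in\{0,1\}^s,0\le i\le n}$ be real numbers such that for every $x$, $|\tilde p_{x,i}-p_{x,i}|\le 2\varepsilon$ for all $i<n$, and $\tilde p_{x,n}=B(H(x))$. Then the following three conditions (the local consistency test) all hold: (1) for every $x\in\{0,1\}^s$, every $0\le i<n$, and every $x_0,x_1\in\{0,1\}^s$ such that $B[v_i(x),0]\sim v_{i+1}(x_0)$ and $B[v_i(x),1]\sim v_{i+1}(x_1)$, we have $\left|\tilde p_{x,i}-\frac{\tilde p_{x_1,i+1}+\tilde p_{x_0,i+1}}{2}\right|\le 5\varepsilon$; (2) for every $x,x'\in\{0,1\}^s$ and $i$ such that $v_i(x)\sim v_i(x')$, we have $|\tilde p_{x,i}-\tilde p_{x',i}|\le 5\varepsilon$; (3) for every $x\in\{0,1\}^s$, $\tilde p_{x,n}=B(H(x))$.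
   Context: An ordered branching program (OBP) of length $n$ and width $w$ has layers $V_0,\ldots,V_n$ with $|V_i|\le w$, a single start state $v_0\in V_0$, two outgoing edges labeled $0$ and $1$ from each state of $V_i$ ($i<n$) into $V_{i+1}$, and labels in $\{0,1\}$ on $V_n$. $B[v,\sigma]$ is the state reached from $v$ following the edges labeled by $\sigma$, and $B(x)$ is the label of $B[v_0,x]$. For $v\in V_i$, $p_{v\to}=\Pr_{r\in\{0,1\}^{n-i}\text{ uniform}}[B[v,r]\text{ has label }1]$. An $\varepsilon$-hitting set generator $H$ for a class $\mathcal{F}$ of functions $\{0,1\}^n\to\{0,1\}$ satisfies: every $f\in\mathcal{F}$ with $\Pr_{x\text{ uniform}}[f(x)=1]\ge\varepsilon$ has $f(H(y))=1$ for some $y$. Define $v_i(x)=B[v_0,H(x)_{1..i}]$ (where $H(x)_{1..i}$ is the first $i$ bits of $H(x)$) and $p_{x,i}=p_{v_i(x)\to}$. For states $u,u'\in V_i$, write $u\sim u'$ (indistinguishable under $H$) if $B[u,H(y)_{1..n-i}]=B[u',H(y)_{1..n-i}]$ for all $y\in\{0,1\}^s$.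
   Formalization: The parameter $\varepsilon$ and the numbers $\tilde p_{x,i}$ are rational rather than real. -}

module Defs where

open import Data.Bool using (Bool; true; false; if_then_else_)
open import Data.Nat using (ℕ; zero; suc; _∸_; _^_; _*_)
open import Data.Nat.Properties using (m^n≢0)
open import Data.Fin using (Fin)
open import Data.Vec using (Vec; []; _∷_; toList)
open import Data.List using (List; []; _∷_; take; length; filter; map; _++_)
open import Data.Integer using (+_)
open import Data.Rational using (ℚ; _/_; 0ℚ; 1ℚ)
open import Relation.Binary.PropositionalEquality using (_≡_)
open import Data.Bool.Properties using () renaming (_≟_ to _≟B_)
open import Data.Product using (∃)

-- Each layer V_i (0 ≤ i ≤ n) is represented by (a subset of) Fin w, so |V_i| ≤ w.
-- step i u b : the state of V_{i+1} reached from u ∈ V_i along the edge labelled b.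
-- Only the layers i < n are ever used (values of step at i ≥ n are irrelevant).
-- label : labels of the states of the last layer V_n.
record OBP (w n : ℕ) : Set where
  field
    start : Fin w
    step  : ℕ → Fin w → Bool → Fin w
    label : Fin w → Bool
open OBP public

run : ∀ {w n} → OBP w n → ℕ → Fin w → List Bool → Fin w
run B i u []      = u
run B i u (b ∷ σ) = run B (suc i) (step B i u b) σ

eval : ∀ {w n} → OBP w n → Vec Bool n → Bool
eval B x = label B (run B 0 (start B) (toList x))

allBits : (k : ℕ) → List (Vec Bool k)
allBits zero    = [] ∷ []
allBits (suc k) = map (false ∷_) (allBits k) ++ map (true ∷_) (allBits k)

prob : (k : ℕ) → (Vec Bool k → Bool) → ℚ
prob k f = (+ length (filter (λ r → f r ≟B true) (allBits k))) / (2 ^ k)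
  where instance _ = m^n≢0 2 k

pTo : ∀ {w n} → OBP w n → ℕ → Fin w → ℚ
pTo {n = n} B i v = prob (n ∸ i) (λ r → label B (run B i v (toList r)))

IsHSG : ∀ {s n} → (w' : ℕ) → ℚ → (Vec Bool s → Vec Bool n) → Set
IsHSG {s} {n} w' ε H =
  (B' : OBP w' n) → ε Data.Rational.≤ prob n (eval B') →
  ∃ λ (y : Vec Bool s) → eval B' (H y) ≡ true

vAt : ∀ {w n s} → OBP w n → (Vec Bool s → Vec Bool n) → Vec Bool s → ℕ → Fin w
vAt B H x i = run B 0 (start B) (take i (toList (H x)))

pAt : ∀ {w n s} → OBP w n → (Vec Bool s → Vec Bool n) → Vec Bool s → ℕ → ℚ
pAt B H x i = pTo B i (vAt B H x i)

Indist : ∀ {w n s} → OBP w n → (Vec Bool s → Vec Bool n) → ℕ → Fin w → Fin w → Set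
Indist {n = n} {s} B H i u u' =
  (y : Vec Bool s) →
  run B i u (take (n ∸ i) (toList (H y))) ≡ run B i u' (take (n ∸ i) (toList (H y)))

bitℚ : Bool → ℚ
bitℚ b = if b then 1ℚ else 0ℚ

{-# OPTIONS --safe #-}
-- Exactly, p_{v→} is the average of p_{B[v,0]→} and p_{B[v,1]→}, and indistinguishable states
-- u ∼ u' satisfy |p_{u→} − p_{u'→}| < ε: run B from u and from u' in parallel, accepting iff u
-- accepts and u' rejects. This width-w² program accepts with probability ≥ p_{u→} − p_{u'→}, yet
-- on no output of H, since H cannot separate u from u'; as H is an ε-hitting set generator, that
-- probability is < ε. Passing to the estimates costs 2ε at each end of a comparison: 2ε + ε + 2ε = 5ε.
module Submission where

open import Defs
open import Data.Bool using (Bool; false; true)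
open import Data.Nat using (ℕ; suc) renaming (_≤_ to _≤ℕ_; _<_ to _<ℕ_; _*_ to _*ℕ_)
open import Data.Vec using (Vec)
open import Data.Product using (_×_)
open import Data.Integer using (+_)
open import Data.Rational using (ℚ; _≤_; _<_; _+_; _-_; _*_; ∣_∣; ½; 0ℚ; _/_)
open import Relation.Binary.PropositionalEquality using (_≡_)

open import Data.Bool using (if_then_else_; _∧_; not)
open import Data.Bool.Properties using (∧-inverseʳ) renaming (_≟_ to _≟B_)
open import Data.Nat as ℕ using (zero; NonZero; _∸_; _^_; z≤n; s≤s)
import Data.Nat.Properties as ℕ
open import Data.Integer as ℤ using (1ℤ)
import Data.Integer.Properties as ℤ
open import Data.Integer.Tactic.RingSolver using (solve-∀)
open import Data.Rational using (-_; toℚᵘ; *≤*)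
open import Data.Rational.Properties
open import Data.Rational.Solver using (module +-*-Solver)
import Data.Rational.Unnormalised as ℚᵘ
import Data.Rational.Unnormalised.Properties as ℚᵘ
open import Data.List using (List; []; _∷_; length; filter; map; _++_; take)
open import Data.List.Properties using (length-++; filter-++; take-all)
open import Data.Vec using ([]; _∷_; toList)
open import Data.Vec.Properties using (length-toList)
open import Data.Fin using (Fin; combine; remQuot)
open import Data.Fin.Properties using (remQuot-combine)
open import Data.Product using (_,_; proj₁; proj₂)
open import Data.Sum using (inj₁; inj₂)
open import Function using (_∘_)
open import Relation.Nullary using (does; contradiction)
open import Relation.Nullary.Decidable using (dec-true; dec-false)
open import Relation.Binary.PropositionalEquality using (refl; sym; trans; cong; cong₂; subst; module ≡-Reasoning)

open +-*-Solver using (solve; _:+_; _:*_; _:-_; :-_; con; _:=_)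

toℚᵘ-/ : ∀ m d .{{_ : NonZero d}} → toℚᵘ (m / d) ℚᵘ.≃ (m ℚᵘ./ d)
toℚᵘ-/ m (suc d) = toℚᵘ-fromℚᵘ (ℚᵘ.mkℚᵘ m d)

/-average : ∀ m n d .{{_ : NonZero d}} .{{_ : NonZero (2 ℕ.* d)}} →
  + (m ℕ.+ n) / (2 ℕ.* d) ≡ (+ m / d + + n / d) * ½
/-average m n d@(suc _) = toℚᵘ-injective (begin
  toℚᵘ (+ (m ℕ.+ n) / (2 ℕ.* d))
    ≈⟨ toℚᵘ-/ (+ (m ℕ.+ n)) (2 ℕ.* d) ⟩
  + (m ℕ.+ n) ℚᵘ./ (2 ℕ.* d)
    ≈⟨ ℚᵘ.*≡* cross-multiplied ⟨
  (+ m ℚᵘ./ d ℚᵘ.+ + n ℚᵘ./ d) ℚᵘ.* ℚᵘ.½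
    ≈⟨ ℚᵘ.*-cong (ℚᵘ.+-cong (toℚᵘ-/ (+ m) d) (toℚᵘ-/ (+ n) d)) (toℚᵘ-/ 1ℤ 2) ⟨
  (toℚᵘ (+ m / d) ℚᵘ.+ toℚᵘ (+ n / d)) ℚᵘ.* toℚᵘ ½
    ≈⟨ ℚᵘ.*-cong (toℚᵘ-homo-+ (+ m / d) (+ n / d)) ℚᵘ.≃-refl ⟨
  toℚᵘ (+ m / d + + n / d) ℚᵘ.* toℚᵘ ½
    ≈⟨ toℚᵘ-homo-* (+ m / d + + n / d) ½ ⟨
  toℚᵘ ((+ m / d + + n / d) * ½) ∎)
  where
  open ℚᵘ.≃-Reasoning
  rearrange : ∀ x y z → ((x ℤ.* z ℤ.+ y ℤ.* z) ℤ.* 1ℤ) ℤ.* (+ 2 ℤ.* z) ≡ (x ℤ.+ y) ℤ.* ((z ℤ.* z) ℤ.* + 2)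
  rearrange = solve-∀
  cross-multiplied : ((+ m ℤ.* + d ℤ.+ + n ℤ.* + d) ℤ.* 1ℤ) ℤ.* + (2 ℕ.* d)
                   ≡ + (m ℕ.+ n) ℤ.* ((+ d ℤ.* + d) ℤ.* + 2)
  cross-multiplied = trans (cong (((+ m ℤ.* + d ℤ.+ + n ℤ.* + d) ℤ.* 1ℤ) ℤ.*_) (ℤ.pos-* 2 d))
    (trans (rearrange (+ m) (+ n) (+ d)) (cong (ℤ._* ((+ d ℤ.* + d) ℤ.* + 2)) (sym (ℤ.pos-+ m n))))

[p+p]*½≡p : ∀ p → (p + p) * ½ ≡ p
[p+p]*½≡p = solve 1 (λ p → (p :+ p) :* con ½ := p) refl

∣p-q∣≡∣q-p∣ : ∀ p q → ∣ p - q ∣ ≡ ∣ q - p ∣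
∣p-q∣≡∣q-p∣ p q = trans (cong ∣_∣ (solve 2 (λ p q → p :- q := :- (q :- p)) refl p q)) (∣-p∣≡∣p∣ (q - p))

∣-∣-sym : ∀ p q {r} → ∣ p - q ∣ ≤ r → ∣ q - p ∣ ≤ r
∣-∣-sym p q {r} = subst (_≤ r) (∣p-q∣≡∣q-p∣ p q)

∣p-r∣≤∣p-q∣+∣q-r∣ : ∀ p q r → ∣ p - r ∣ ≤ ∣ p - q ∣ + ∣ q - r ∣
∣p-r∣≤∣p-q∣+∣q-r∣ p q r = begin
  ∣ p - r ∣               ≡⟨ cong ∣_∣ (solve 3 (λ p q r → p :- r := (p :- q) :+ (q :- r)) refl p q r) ⟩
  ∣ (p - q) + (q - r) ∣   ≤⟨ ∣p+q∣≤∣p∣+∣q∣ (p - q) (q - r) ⟩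
  ∣ p - q ∣ + ∣ q - r ∣   ∎
  where open ≤-Reasoning

∣-∣-trans₃ : ∀ p q q' r {a b c} → ∣ p - q ∣ ≤ a → ∣ q - q' ∣ ≤ b → ∣ q' - r ∣ ≤ c → ∣ p - r ∣ ≤ a + b + c
∣-∣-trans₃ p q q' r p≈q q≈q' q'≈r = ≤-trans (∣p-r∣≤∣p-q∣+∣q-r∣ p q' r)
  (+-mono-≤ (≤-trans (∣p-r∣≤∣p-q∣+∣q-r∣ p q q') (+-mono-≤ p≈q q≈q')) q'≈r)

p≤r+q⇒q≤r+p⇒∣p-q∣≤r : ∀ {p q r} → p ≤ r + q → q ≤ r + p → ∣ p - q ∣ ≤ r
p≤r+q⇒q≤r+p⇒∣p-q∣≤r {p} {q} {r} p≤r+q q≤r+p with ∣p∣≡p∨∣p∣≡-p (p - q)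
... | inj₁ ∣p-q∣≡p-q = begin
  ∣ p - q ∣      ≡⟨ ∣p-q∣≡p-q ⟩
  p - q          ≤⟨ +-monoˡ-≤ (- q) p≤r+q ⟩
  r + q - q      ≡⟨ solve 2 (λ r q → r :+ q :- q := r) refl r q ⟩
  r              ∎
  where open ≤-Reasoning
... | inj₂ ∣p-q∣≡-[p-q] = begin
  ∣ p - q ∣      ≡⟨ ∣p-q∣≡-[p-q] ⟩
  - (p - q)      ≡⟨ solve 2 (λ p q → :- (p :- q) := q :- p) refl p q ⟩
  q - p          ≤⟨ +-monoˡ-≤ (- p) q≤r+p ⟩
  r + p - p      ≡⟨ solve 2 (λ r p → r :+ p :- p := r) refl r p ⟩
  r              ∎
  where open ≤-Reasoning

∣[p+q]*½-[p'+q']*½∣≤r : ∀ p q p' q' {r} → ∣ p - p' ∣ ≤ r → ∣ q - q' ∣ ≤ r →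
  ∣ (p + q) * ½ - (p' + q') * ½ ∣ ≤ r
∣[p+q]*½-[p'+q']*½∣≤r p q p' q' {r} p≈p' q≈q' = begin
  ∣ (p + q) * ½ - (p' + q') * ½ ∣
    ≡⟨ cong ∣_∣ (solve 4 (λ p q p' q' → (p :+ q) :* con ½ :- (p' :+ q') :* con ½
                                        := ((p :- p') :+ (q :- q')) :* con ½) refl p q p' q') ⟩
  ∣ ((p - p') + (q - q')) * ½ ∣
    ≡⟨ ∣p*q∣≡∣p∣*∣q∣ ((p - p') + (q - q')) ½ ⟩
  ∣ (p - p') + (q - q') ∣ * ½
    ≤⟨ *-monoʳ-≤-nonNeg ½ (≤-trans (∣p+q∣≤∣p∣+∣q∣ (p - p') (q - q')) (+-mono-≤ p≈p' q≈q')) ⟩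
  (r + r) * ½
    ≡⟨ [p+p]*½≡p r ⟩
  r ∎
  where open ≤-Reasoning

hits : {A : Set} → (A → Bool) → List A → ℕ
hits f xs = length (filter (λ x → f x ≟B true) xs)

hits-++ : {A : Set} (f : A → Bool) (xs ys : List A) → hits f (xs ++ ys) ≡ hits f xs ℕ.+ hits f ys
hits-++ f xs ys = trans (cong length (filter-++ (λ x → f x ≟B true) xs ys)) (length-++ (filter _ xs))

hits-map : {A B : Set} (f : B → Bool) (g : A → B) (xs : List A) → hits f (map g xs) ≡ hits (f ∘ g) xs
hits-map f g []       = refl
hits-map f g (x ∷ xs) with f (g x)
... | true  = cong suc (hits-map f g xs)
... | false = hits-map f g xs

prob-zero : (f : Vec Bool 0 → Bool) → prob 0 f ≡ bitℚ (f [])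
prob-zero f with f []
... | true  = refl
... | false = refl

prob-suc : ∀ k (f : Vec Bool (suc k) → Bool) →
  prob (suc k) f ≡ (prob k (f ∘ (false ∷_)) + prob k (f ∘ (true ∷_))) * ½
prob-suc k f = begin
  + hits f (map (false ∷_) bits ++ map (true ∷_) bits) / 2 ^ suc k
    ≡⟨ /-cong (cong +_ (hits-++ f (map (false ∷_) bits) (map (true ∷_) bits))) refl ⟩
  + (hits f (map (false ∷_) bits) ℕ.+ hits f (map (true ∷_) bits)) / 2 ^ suc k
    ≡⟨ /-cong (cong +_ (cong₂ ℕ._+_ (hits-map f (false ∷_) bits) (hits-map f (true ∷_) bits))) refl ⟩
  + (hits (f ∘ (false ∷_)) bits ℕ.+ hits (f ∘ (true ∷_)) bits) / 2 ^ suc k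
    ≡⟨ /-average (hits (f ∘ (false ∷_)) bits) (hits (f ∘ (true ∷_)) bits) (2 ^ k) ⟩
  (prob k (f ∘ (false ∷_)) + prob k (f ∘ (true ∷_))) * ½ ∎
  where
  open ≡-Reasoning
  bits : List (Vec Bool k)
  bits = allBits k
  instance
    2^k≢0 : NonZero (2 ^ k)
    2^k≢0 = ℕ.m^n≢0 2 k
    2^1+k≢0 : NonZero (2 ^ suc k)
    2^1+k≢0 = ℕ.m^n≢0 2 (suc k)

prob-cong : ∀ k {f g : Vec Bool k → Bool} → (∀ r → f r ≡ g r) → prob k f ≡ prob k g
prob-cong zero    {f} {g} f≗g = trans (prob-zero f) (trans (cong bitℚ (f≗g [])) (sym (prob-zero g)))
prob-cong (suc k) {f} {g} f≗g = begin
  prob (suc k) f                                           ≡⟨ prob-suc k f ⟩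
  (prob k (f ∘ (false ∷_)) + prob k (f ∘ (true ∷_))) * ½   ≡⟨ cong₂ (λ p q → (p + q) * ½)
                                                                (prob-cong k (f≗g ∘ (false ∷_)))
                                                                (prob-cong k (f≗g ∘ (true ∷_))) ⟩
  (prob k (g ∘ (false ∷_)) + prob k (g ∘ (true ∷_))) * ½   ≡⟨ prob-suc k g ⟨
  prob (suc k) g                                           ∎
  where open ≡-Reasoning

prob-const : ∀ k b → prob k (λ _ → b) ≡ bitℚ b
prob-const zero    b = prob-zero (λ _ → b)
prob-const (suc k) b = begin
  prob (suc k) (λ _ → b)                     ≡⟨ prob-suc k (λ _ → b) ⟩
  (prob k (λ _ → b) + prob k (λ _ → b)) * ½  ≡⟨ cong (λ p → (p + p) * ½) (prob-const k b) ⟩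
  (bitℚ b + bitℚ b) * ½                      ≡⟨ [p+p]*½≡p (bitℚ b) ⟩
  bitℚ b                                     ∎
  where open ≡-Reasoning

prob-take : ∀ {k n} → k ≤ℕ n → (g : List Bool → Bool) →
  prob n (λ r → g (take k (toList r))) ≡ prob k (λ r → g (toList r))
prob-take {zero}  {n}     z≤n       g = trans (prob-const n (g [])) (sym (prob-zero (λ r → g (toList r))))
prob-take {suc k} {suc n} (s≤s k≤n) g = begin
  prob (suc n) (λ r → g (take (suc k) (toList r)))
    ≡⟨ prob-suc n _ ⟩
  (prob n (λ r → g (false ∷ take k (toList r))) + prob n (λ r → g (true ∷ take k (toList r)))) * ½
    ≡⟨ cong₂ (λ p q → (p + q) * ½) (prob-take k≤n (g ∘ (false ∷_))) (prob-take k≤n (g ∘ (true ∷_))) ⟩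
  (prob k (λ r → g (false ∷ toList r)) + prob k (λ r → g (true ∷ toList r))) * ½
    ≡⟨ prob-suc k _ ⟨
  prob (suc k) (λ r → g (toList r)) ∎
  where open ≡-Reasoning

prob-subadditive : ∀ k {f g h : Vec Bool k → Bool} → (∀ r → bitℚ (f r) ≤ bitℚ (g r) + bitℚ (h r)) →
  prob k f ≤ prob k g + prob k h
prob-subadditive zero {f} {g} {h} f≤g+h = begin
  prob 0 f                  ≡⟨ prob-zero f ⟩
  bitℚ (f [])               ≤⟨ f≤g+h [] ⟩
  bitℚ (g []) + bitℚ (h []) ≡⟨ cong₂ _+_ (prob-zero g) (prob-zero h) ⟨
  prob 0 g + prob 0 h       ∎
  where open ≤-Reasoning
prob-subadditive (suc k) {f} {g} {h} f≤g+h = begin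
  prob (suc k) f
    ≡⟨ prob-suc k f ⟩
  (prob k (f ∘ (false ∷_)) + prob k (f ∘ (true ∷_))) * ½
    ≤⟨ *-monoʳ-≤-nonNeg ½ (+-mono-≤ (prob-subadditive k (f≤g+h ∘ (false ∷_)))
                                     (prob-subadditive k (f≤g+h ∘ (true ∷_)))) ⟩
  ((g₀ + h₀) + (g₁ + h₁)) * ½
    ≡⟨ solve 4 (λ a b c d → ((a :+ b) :+ (c :+ d)) :* con ½ := (a :+ c) :* con ½ :+ (b :+ d) :* con ½)
               refl g₀ h₀ g₁ h₁ ⟩
  (g₀ + g₁) * ½ + (h₀ + h₁) * ½
    ≡⟨ cong₂ _+_ (prob-suc k g) (prob-suc k h) ⟨
  prob (suc k) g + prob (suc k) h ∎
  where
  open ≤-Reasoning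
  g₀ g₁ h₀ h₁ : ℚ
  g₀ = prob k (g ∘ (false ∷_))
  g₁ = prob k (g ∘ (true ∷_))
  h₀ = prob k (h ∘ (false ∷_))
  h₁ = prob k (h ∘ (true ∷_))

bitℚ-≤-∧-not : ∀ a b → bitℚ a ≤ bitℚ (a ∧ not b) + bitℚ b
bitℚ-≤-∧-not true  true  = ≤-refl
bitℚ-≤-∧-not true  false = ≤-refl
bitℚ-≤-∧-not false true  = *≤* (ℤ.+≤+ z≤n)
bitℚ-≤-∧-not false false = ≤-refl

never-hit⇒prob<ε : ∀ {s n w'} {ε : ℚ} (H : Vec Bool s → Vec Bool n) → IsHSG w' ε H →
  (B' : OBP w' n) → (∀ y → eval B' (H y) ≡ false) → prob n (eval B') < ε
never-hit⇒prob<ε H hsg B' rejects = ≰⇒> λ ε≤prob →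
  let (y , accepts) = hsg B' ε≤prob in contradiction (trans (sym accepts) (rejects y)) λ ()

pTo-step : ∀ {w n} (B : OBP w n) i v → i <ℕ n →
  pTo B i v ≡ (pTo B (suc i) (step B i v false) + pTo B (suc i) (step B i v true)) * ½
pTo-step {n = n} B i v i<n rewrite ℕ.+-∸-assoc 1 i<n = prob-suc (n ∸ suc i) _

pTo-last : ∀ {w n} (B : OBP w n) v → pTo B n v ≡ bitℚ (label B v)
pTo-last {n = n} B v rewrite ℕ.n∸n≡0 n = prob-zero (λ r → label B (run B n v (toList r)))

take-toList : ∀ {A : Set} {n} (v : Vec A n) → take n (toList v) ≡ toList v
take-toList v = take-all _ (toList v) (ℕ.≤-reflexive (length-toList v))

pAt-last : ∀ {w n s} (B : OBP w n) (H : Vec Bool s → Vec Bool n) x → pAt B H x n ≡ bitℚ (eval B (H x))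
pAt-last {n = n} B H x = trans (pTo-last B (vAt B H x n))
  (cong (λ σ → bitℚ (label B (run B 0 (start B) σ))) (take-toList (H x)))

left right : ∀ {w} → Fin (w ℕ.* w) → Fin w
left  {w} = proj₁ ∘ remQuot {w} w
right {w} = proj₂ ∘ remQuot {w} w

left-combine : ∀ {w} (a a' : Fin w) → left (combine a a') ≡ a
left-combine {w} a a' = cong proj₁ (remQuot-combine {w} {w} a a')

right-combine : ∀ {w} (a a' : Fin w) → right (combine a a') ≡ a'
right-combine {w} a a' = cong proj₂ (remQuot-combine {w} {w} a a')

-- Idles after k steps: below layer i, B has only n ∸ i layers, while this program has length n.
distinguisher : ∀ {w n} → OBP w n → (i k : ℕ) → Fin w → Fin w → OBP (w ℕ.* w) n
distinguisher B i k u u' = record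
  { start = combine u u'
  ; step  = λ j c b → if does (j ℕ.<? k)
                        then combine (step B (j ℕ.+ i) (left c) b) (step B (j ℕ.+ i) (right c) b)
                        else c
  ; label = λ c → label B (left c) ∧ not (label B (right c))
  }

module _ {w n} (B : OBP w n) (i k : ℕ) (u u' : Fin w) where
  private D = distinguisher B i k u u'

  run-distinguisher-frozen : ∀ {j} → k ≤ℕ j → ∀ c σ → run D j c σ ≡ c
  run-distinguisher-frozen k≤j c []      = refl
  run-distinguisher-frozen {j} k≤j c (b ∷ σ) rewrite dec-false (j ℕ.<? k) (ℕ.≤⇒≯ k≤j) =
    run-distinguisher-frozen (ℕ.m≤n⇒m≤1+n k≤j) c σ

  step-distinguisher-active : ∀ {j} → j <ℕ k → ∀ a a' b →
    step D j (combine a a') b ≡ combine (step B (j ℕ.+ i) a b) (step B (j ℕ.+ i) a' b)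
  step-distinguisher-active {j} j<k a a' b rewrite dec-true (j ℕ.<? k) j<k =
    cong₂ (λ c c' → combine (step B (j ℕ.+ i) c b) (step B (j ℕ.+ i) c' b))
      (left-combine a a') (right-combine a a')

  run-distinguisher : ∀ j m → j ℕ.+ m ≡ k → ∀ a a' σ →
    run D j (combine a a') σ ≡ combine (run B (j ℕ.+ i) a (take m σ)) (run B (j ℕ.+ i) a' (take m σ))
  run-distinguisher j zero    j+0≡k a a' σ =
    run-distinguisher-frozen (ℕ.≤-reflexive (trans (sym j+0≡k) (ℕ.+-identityʳ j))) _ σ
  run-distinguisher j (suc m) j+m≡k a a' []      = refl
  run-distinguisher j (suc m) j+m≡k a a' (b ∷ σ) = begin
    run D (suc j) (step D j (combine a a') b) σ
      ≡⟨ cong (λ c → run D (suc j) c σ) (step-distinguisher-active j<k a a' b) ⟩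
    run D (suc j) (combine (step B (j ℕ.+ i) a b) (step B (j ℕ.+ i) a' b)) σ
      ≡⟨ run-distinguisher (suc j) m (trans (sym (ℕ.+-suc j m)) j+m≡k) _ _ σ ⟩
    combine (run B (suc j ℕ.+ i) (step B (j ℕ.+ i) a b) (take m σ))
            (run B (suc j ℕ.+ i) (step B (j ℕ.+ i) a' b) (take m σ)) ∎
    where
    open ≡-Reasoning
    j<k : j <ℕ k
    j<k = subst (j <ℕ_) j+m≡k (ℕ.m<m+n j ℕ.z<s)

  eval-distinguisher : ∀ z → eval D z ≡ label B (run B i u (take k (toList z)))
                                       ∧ not (label B (run B i u' (take k (toList z))))
  eval-distinguisher z = trans (cong (label D) (run-distinguisher 0 k refl u u' (toList z)))
    (cong₂ (λ c c' → label B c ∧ not (label B c')) (left-combine a a') (right-combine a a'))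
    where
    a a' : Fin w
    a  = run B i u (take k (toList z))
    a' = run B i u' (take k (toList z))

module _ {s w n} (B : OBP w n) (H : Vec Bool s → Vec Bool n) (i : ℕ) (u u' : Fin w)
         (u∼u' : Indist B H i u u') where
  private D = distinguisher B i (n ∸ i) u u'

  distinguisher-rejects-H : ∀ y → eval D (H y) ≡ false
  distinguisher-rejects-H y = trans (eval-distinguisher B i (n ∸ i) u u' (H y))
    (trans (cong (λ c → label B c ∧ not (label B (run B i u' σ))) (u∼u' y))
           (∧-inverseʳ (label B (run B i u' σ))))
    where
    σ : List Bool
    σ = take (n ∸ i) (toList (H y))

  pTo-≤-prob-distinguisher : pTo B i u ≤ prob n (eval D) + pTo B i u'
  pTo-≤-prob-distinguisher = begin
    prob k (λ r → accepts-u (toList r))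
      ≤⟨ prob-subadditive k (λ r → bitℚ-≤-∧-not (accepts-u (toList r)) (accepts-u' (toList r))) ⟩
    prob k (λ r → accepts-u (toList r) ∧ not (accepts-u' (toList r))) + pTo B i u'
      ≡⟨ cong (_+ pTo B i u') (prob-take (ℕ.m∸n≤m n i) (λ σ → accepts-u σ ∧ not (accepts-u' σ))) ⟨
    prob n (λ z → accepts-u (take k (toList z)) ∧ not (accepts-u' (take k (toList z)))) + pTo B i u'
      ≡⟨ cong (_+ pTo B i u') (prob-cong n (eval-distinguisher B i k u u')) ⟨
    prob n (eval D) + pTo B i u' ∎
    where
    open ≤-Reasoning
    k : ℕ
    k = n ∸ i
    accepts-u accepts-u' : List Bool → Bool
    accepts-u  σ = label B (run B i u σ)
    accepts-u' σ = label B (run B i u' σ)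

  pTo-≤-ε+pTo : ∀ {ε} → IsHSG (w *ℕ w) ε H → pTo B i u ≤ ε + pTo B i u'
  pTo-≤-ε+pTo hsg = ≤-trans pTo-≤-prob-distinguisher
    (+-monoˡ-≤ (pTo B i u') (<⇒≤ (never-hit⇒prob<ε H hsg D distinguisher-rejects-H)))

indist⇒∣pTo-pTo∣≤ε : ∀ {s w n ε} (H : Vec Bool s → Vec Bool n) → IsHSG (w *ℕ w) ε H →
  (B : OBP w n) → ∀ i u u' → Indist B H i u u' → ∣ pTo B i u - pTo B i u' ∣ ≤ ε
indist⇒∣pTo-pTo∣≤ε H hsg B i u u' u∼u' = p≤r+q⇒q≤r+p⇒∣p-q∣≤r
  (pTo-≤-ε+pTo B H i u u' u∼u' hsg) (pTo-≤-ε+pTo B H i u' u (sym ∘ u∼u') hsg)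

pt≈pAt-up-to-last : ∀ {s w n δ} (H : Vec Bool s → Vec Bool n) (B : OBP w n) (pt : Vec Bool s → ℕ → ℚ) →
  0ℚ ≤ δ → (∀ x i → i <ℕ n → ∣ pt x i - pAt B H x i ∣ ≤ δ) → (∀ x → pt x n ≡ bitℚ (eval B (H x))) →
  ∀ x i → i ≤ℕ n → ∣ pt x i - pAt B H x i ∣ ≤ δ
pt≈pAt-up-to-last {n = n} {δ} H B pt 0≤δ pt≈pAt pt-last x i i≤n with ℕ.m≤n⇒m<n∨m≡n i≤n
... | inj₁ i<n  = pt≈pAt x i i<n
... | inj₂ refl = begin
  ∣ pt x n - pAt B H x n ∣ ≡⟨ cong₂ (λ p q → ∣ p - q ∣) (pt-last x) (pAt-last B H x) ⟩
  ∣ b - b ∣                ≡⟨ cong ∣_∣ (+-inverseʳ b) ⟩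
  0ℚ                       ≤⟨ 0≤δ ⟩
  δ                        ∎
  where
  open ≤-Reasoning
  b : ℚ
  b = bitℚ (eval B (H x))

module _ {s w n ε δ} (H : Vec Bool s → Vec Bool n) (hsg : IsHSG (w *ℕ w) ε H) (B : OBP w n)
         (pt : Vec Bool s → ℕ → ℚ) (pt≈pAt : ∀ x i → i ≤ℕ n → ∣ pt x i - pAt B H x i ∣ ≤ δ) where

  step-consistent : ∀ x i → i <ℕ n → ∀ x₀ x₁ →
    Indist B H (suc i) (step B i (vAt B H x i) false) (vAt B H x₀ (suc i)) →
    Indist B H (suc i) (step B i (vAt B H x i) true) (vAt B H x₁ (suc i)) →
    ∣ pt x i - (pt x₁ (suc i) + pt x₀ (suc i)) * ½ ∣ ≤ δ + ε + δ
  step-consistent x i i<n x₀ x₁ v₀∼ v₁∼ =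
    ∣-∣-trans₃ (pt x i) (pAt B H x i) average ((pt x₁ (suc i) + pt x₀ (suc i)) * ½)
      (pt≈pAt x i (ℕ.<⇒≤ i<n)) pAt≈average average≈pt-average
    where
    v : Fin w
    v = vAt B H x i
    q₀ q₁ average : ℚ
    q₀ = pTo B (suc i) (step B i v false)
    q₁ = pTo B (suc i) (step B i v true)
    average = (pAt B H x₁ (suc i) + pAt B H x₀ (suc i)) * ½
    pAt≈average : ∣ pAt B H x i - average ∣ ≤ ε
    pAt≈average = subst (λ p → ∣ p - average ∣ ≤ ε)
      (sym (trans (pTo-step B i v i<n) (cong (_* ½) (+-comm q₀ q₁))))
      (∣[p+q]*½-[p'+q']*½∣≤r q₁ q₀ (pAt B H x₁ (suc i)) (pAt B H x₀ (suc i))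
        (indist⇒∣pTo-pTo∣≤ε H hsg B (suc i) (step B i v true) (vAt B H x₁ (suc i)) v₁∼)
        (indist⇒∣pTo-pTo∣≤ε H hsg B (suc i) (step B i v false) (vAt B H x₀ (suc i)) v₀∼))
    pAt≈pt : ∀ x' → ∣ pAt B H x' (suc i) - pt x' (suc i) ∣ ≤ δ
    pAt≈pt x' = ∣-∣-sym (pt x' (suc i)) (pAt B H x' (suc i)) (pt≈pAt x' (suc i) i<n)
    average≈pt-average : ∣ average - (pt x₁ (suc i) + pt x₀ (suc i)) * ½ ∣ ≤ δ
    average≈pt-average = ∣[p+q]*½-[p'+q']*½∣≤r (pAt B H x₁ (suc i)) (pAt B H x₀ (suc i))
      (pt x₁ (suc i)) (pt x₀ (suc i)) (pAt≈pt x₁) (pAt≈pt x₀)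

  indist-consistent : ∀ x x' i → i ≤ℕ n → Indist B H i (vAt B H x i) (vAt B H x' i) →
    ∣ pt x i - pt x' i ∣ ≤ δ + ε + δ
  indist-consistent x x' i i≤n v∼v' =
    ∣-∣-trans₃ (pt x i) (pAt B H x i) (pAt B H x' i) (pt x' i)
      (pt≈pAt x i i≤n)
      (indist⇒∣pTo-pTo∣≤ε H hsg B i (vAt B H x i) (vAt B H x' i) v∼v')
      (∣-∣-sym (pt x' i) (pAt B H x' i) (pt≈pAt x' i i≤n))

lemma6p11 : {s n w : ℕ} (ε : ℚ) → 0ℚ < ε →
    (H : Vec Bool s → Vec Bool n) → IsHSG (w *ℕ w) ε H →
    (B : OBP w n) →
    (pt : Vec Bool s → ℕ → ℚ) →
    (∀ x i → i <ℕ n → ∣ pt x i - pAt B H x i ∣ ≤ (+ 2 / 1) * ε) →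
    (∀ x → pt x n ≡ bitℚ (eval B (H x))) →
    ((∀ x i → i <ℕ n → ∀ x₀ x₁ →
        Indist B H (suc i) (step B i (vAt B H x i) false) (vAt B H x₀ (suc i)) →
        Indist B H (suc i) (step B i (vAt B H x i) true) (vAt B H x₁ (suc i)) →
        ∣ pt x i - (pt x₁ (suc i) + pt x₀ (suc i)) * ½ ∣ ≤ (+ 5 / 1) * ε)
     × (∀ x x' i → i ≤ℕ n → Indist B H i (vAt B H x i) (vAt B H x' i) →
        ∣ pt x i - pt x' i ∣ ≤ (+ 5 / 1) * ε)
     × (∀ x → pt x n ≡ bitℚ (eval B (H x))))
lemma6p11 {n = n} ε 0<ε H hsg B pt pt≈pAt pt-last =
    (λ x i i<n x₀ x₁ v₀∼ v₁∼ → within-5ε (step-consistent H hsg B pt pt≈pAt′ x i i<n x₀ x₁ v₀∼ v₁∼))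
  , (λ x x' i i≤n v∼v' → within-5ε (indist-consistent H hsg B pt pt≈pAt′ x x' i i≤n v∼v'))
  , pt-last
  where
  0≤2ε : 0ℚ ≤ (+ 2 / 1) * ε
  0≤2ε = subst (_≤ (+ 2 / 1) * ε) (*-zeroʳ (+ 2 / 1)) (*-monoˡ-≤-nonNeg (+ 2 / 1) (<⇒≤ 0<ε))
  pt≈pAt′ : ∀ x i → i ≤ℕ n → ∣ pt x i - pAt B H x i ∣ ≤ (+ 2 / 1) * ε
  pt≈pAt′ = pt≈pAt-up-to-last H B pt 0≤2ε pt≈pAt pt-last
  within-5ε : ∀ {d} → d ≤ (+ 2 / 1) * ε + ε + (+ 2 / 1) * ε → d ≤ (+ 5 / 1) * ε
  within-5ε = subst (_ ≤_)
    (solve 1 (λ e → con (+ 2 / 1) :* e :+ e :+ con (+ 2 / 1) :* e := con (+ 5 / 1) :* e) refl ε)
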